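{- Let $\mathcal{D}=(G,x,y)$ be a regular dessin of type $(l,m,n)$, and let $K=\langle x\rangle\cap\langle y\rangle$ have order $k\ge 1$. Then $x^{l/k}=y^{em/k}$ for some integer $e$ coprime to $k$. In particular, if $\mathcal{D}$ is symmetric, then $l=m$ and $e^2\equiv 1\pmod{k}$.
   Context: A regular dessin is a triple $(G,x,y)$ with $G$ a finite group generated by $x,y$. Its type is $(o(x),o(y),o(xy))$, where $o(\cdot)$ denotes element order. The dessin $(G,x,y)$ is symmetric if the assignment $x\mapsto y$, $y\mapsto x$ extends to an automorphism of $G$. -}

module Defs where

open import Level using (Level; _⊔_)
open import Algebra.Bundles using (Group)
open import Algebra.Morphism.Structures using (module GroupMorphisms)
open import Data.Nat using (ℕ; zero; suc; _≤_; _<_)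
open import Data.Integer using (ℤ; +_; -[1+_])
open import Data.Fin using (Fin)
open import Data.Product using (Σ; ∃; _×_)
open import Relation.Binary.PropositionalEquality using (_≡_)
open import Relation.Nullary using (¬_)

module GroupDefs {c ℓ : Level} (G : Group c ℓ) where
  open Group G public using (Carrier; _≈_; _∙_; ε; _⁻¹; rawGroup)

  _^_ : Carrier → ℕ → Carrier
  x ^ zero  = ε
  x ^ suc n = x ∙ (x ^ n)

  _^ℤ_ : Carrier → ℤ → Carrier
  x ^ℤ (+ n)     = x ^ n
  x ^ℤ -[1+ n ]  = (x ^ suc n) ⁻¹

  IsFinite : Set (c ⊔ ℓ)
  IsFinite = Σ ℕ λ N → Σ (Fin N → Carrier) λ f → ∀ g → ∃ λ i → f i ≈ g

  data InGen (x y : Carrier) : Carrier → Set (c ⊔ ℓ) where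
    gen-x  : InGen x y x
    gen-y  : InGen x y y
    gen-ε  : InGen x y ε
    gen-∙  : ∀ {a b} → InGen x y a → InGen x y b → InGen x y (a ∙ b)
    gen-⁻¹ : ∀ {a} → InGen x y a → InGen x y (a ⁻¹)
    gen-≈  : ∀ {a b} → a ≈ b → InGen x y a → InGen x y b

  Generates : Carrier → Carrier → Set (c ⊔ ℓ)
  Generates x y = ∀ g → InGen x y g

  HasOrder : Carrier → ℕ → Set ℓ
  HasOrder x n = (1 ≤ n) × (x ^ n ≈ ε) × (∀ m → 1 ≤ m → m < n → ¬ (x ^ m ≈ ε))

  -- membership in the cyclic subgroup ⟨x⟩ (G finite, so nonnegative powers suffice
  -- but we use integer powers as in the definition of ⟨x⟩)
  InCyclic : Carrier → Carrier → Set ℓ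
  InCyclic x g = ∃ λ (i : ℤ) → g ≈ x ^ℤ i

  HasCard : (Carrier → Set ℓ) → ℕ → Set (c ⊔ ℓ)
  HasCard P k = Σ (Fin k → Carrier) λ f →
      (∀ i → P (f i))
    × (∀ i j → f i ≈ f j → i ≡ j)
    × (∀ g → P g → ∃ λ i → f i ≈ g)

  open GroupMorphisms rawGroup rawGroup using (IsGroupIsomorphism)
  IsSymmetric : Carrier → Carrier → Set (c ⊔ ℓ)
  IsSymmetric x y = Σ (Carrier → Carrier) λ φ →
    IsGroupIsomorphism φ × (φ x ≈ y) × (φ y ≈ x)

module Submission where

-- The argument is the fundamental theorem on cyclic groups.  After an
-- arithmetic lemma (a unit modulo k is coprime to k), the power laws and the
-- arithmetic of exponents modulo the order o of an element z, we show that a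
-- subgroup Q of ⟨z⟩ with k elements satisfies k ∣ o and is generated by z ^ (o/k):
-- its least positive exponent d divides every exponent, and counting the
-- elements z ^ (d·t), t < o/d, gives k = o/d.  Applied to K inside ⟨x⟩ and inside
-- ⟨y⟩, this shows that a = x ^ (l/k) and b = y ^ (m/k) both generate K, so
-- a = b ^ j and b = a ^ i; as b has order k, j·i ≡ 1 (mod k), whence j is coprime
-- to k.  An automorphism swapping x and y preserves orders, so l = m, and it
-- swaps a and b, which forces j·j ≡ 1 (mod k).

open import Defs
open import Level using (Level; _⊔_)
open import Algebra.Bundles using (Group)
open import Algebra.Morphism.Structures using (module GroupMorphisms)
open import Data.Nat using (ℕ; _≤_; _/_; >-nonZero)
open import Data.Nat.Coprimality using (Coprime)
open import Data.Product using (∃; _×_; _,_; proj₁; proj₂)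
open import Relation.Binary.PropositionalEquality using (_≡_)
import Relation.Binary.PropositionalEquality as P

module Congruences where
  open import Data.Nat using (_*_)
  open import Data.Nat.Divisibility using (∣1⇒≡1; ∣m⇒∣m*n)
  open import Data.Integer using (+_; -_; _-_)
  open import Data.Integer.Divisibility.Signed using (_∣_; ∣ᵤ⇒∣; ∣⇒∣ᵤ; ∣-trans; ∣m+n∣m⇒∣n)

  invertible⇒coprime : ∀ {k j i} → + k ∣ + (j * i) - + 1 → Coprime j k
  invertible⇒coprime {k} {j} {i} k∣ji-1 {d} (d∣j , d∣k) = ∣1⇒≡1 (∣⇒∣ᵤ d∣-1)
    where
      d∣ji : + d ∣ + (j * i)
      d∣ji = ∣ᵤ⇒∣ (∣m⇒∣m*n i d∣j)
      d∣-1 : + d ∣ - + 1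
      d∣-1 = ∣m+n∣m⇒∣n {m = + (j * i)} (∣-trans (∣ᵤ⇒∣ d∣k) k∣ji-1) d∣ji

open Congruences

module CyclicSubgroups {c ℓ : Level} (G : Group c ℓ) where
  open import Data.Nat
    using (zero; suc; _+_; _*_; _∸_; _<_; _≤?_; NonZero; z≤n; s≤s; >-nonZero⁻¹)
  open import Data.Nat.Properties
  open import Data.Nat.Divisibility using (_∣_; ∣⇒≤; ∣-antisym; n∣m*n; m%n≡0⇒n∣m)
  open import Data.Nat.DivMod
  import Data.Integer as ℤ
  import Data.Integer.Properties as ℤ
  import Data.Integer.Divisibility as ℤᵘ
  open import Data.Integer.Divisibility.Signed as ℤ∣ using (∣ᵤ⇒∣; ∣⇒∣ᵤ; ∣m⇒∣-m)
  open import Data.Fin as Fin using (Fin)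
  import Data.Fin.Properties as Fin
  open import Data.List using (List; tabulate; filter)
  open import Data.List.Relation.Unary.All as All using (All)
  open import Data.List.Relation.Unary.All.Properties using (all-filter; filter⁺; tabulate⁺)
  open import Data.List.Membership.Propositional using (_∈_)
  open import Data.List.Membership.Propositional.Properties using (∈-filter⁺; ∈-tabulate⁺)
  open import Data.List.Extrema.Nat using (min; min≤⊤; min≤xs; argmin-all)
  open import Data.Sum using (inj₁; inj₂)
  open import Function using (id)
  open import Relation.Nullary using (¬_; contradiction)

  open Group G
  open GroupDefs G using (_^_; _^ℤ_; HasOrder; InCyclic; HasCard)
  open GroupMorphisms rawGroup rawGroup using (IsGroupHomomorphism)
  import Algebra.Properties.Monoid.Mult monoid as Mult
  open import Algebra.Properties.Group G using (identityʳ-unique; inverseʳ-unique; //-rightDividesʳ)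
  open import Relation.Binary.Reasoning.Setoid setoid

  -- z ^ n is the library's n-fold multiple n × z in the monoid of G, so the
  -- power laws are those of Algebra.Properties.Monoid.Mult.
  ^≡× : ∀ z n → z ^ n ≡ n Mult.× z
  ^≡× z zero    = P.refl
  ^≡× z (suc n) = P.cong (z ∙_) (^≡× z n)

  ^-congˡ : ∀ {a b} n → a ≈ b → a ^ n ≈ b ^ n
  ^-congˡ {a} {b} n a≈b = begin
    a ^ n       ≡⟨ ^≡× a n ⟩
    n Mult.× a  ≈⟨ Mult.×-congʳ n a≈b ⟩
    n Mult.× b  ≡⟨ ^≡× b n ⟨
    b ^ n       ∎

  ^-+ : ∀ z m n → z ^ (m + n) ≈ z ^ m ∙ z ^ n
  ^-+ z m n = begin
    z ^ (m + n)              ≡⟨ ^≡× z (m + n) ⟩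
    (m + n) Mult.× z         ≈⟨ Mult.×-homo-+ z m n ⟩
    m Mult.× z ∙ n Mult.× z  ≡⟨ P.cong₂ _∙_ (^≡× z m) (^≡× z n) ⟨
    z ^ m ∙ z ^ n            ∎

  ^-* : ∀ z m n → (z ^ m) ^ n ≈ z ^ (m * n)
  ^-* z m n = begin
    (z ^ m) ^ n            ≡⟨ P.trans (^≡× (z ^ m) n) (P.cong (n Mult.×_) (^≡× z m)) ⟩
    n Mult.× (m Mult.× z)  ≈⟨ Mult.×-assocˡ z n m ⟩
    (n * m) Mult.× z       ≡⟨ P.trans (P.cong (z ^_) (*-comm m n)) (^≡× z (n * m)) ⟨
    z ^ (m * n)            ∎

  ε^ : ∀ n → ε ^ n ≈ ε
  ε^ zero    = refl
  ε^ (suc n) = trans (identityˡ _) (ε^ n)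

  ^ℤ-pos-* : ∀ z p q → z ^ℤ (ℤ.+ p ℤ.* ℤ.+ q) ≈ (z ^ q) ^ p
  ^ℤ-pos-* z p q = begin
    z ^ℤ (ℤ.+ p ℤ.* ℤ.+ q)  ≡⟨ P.cong (z ^ℤ_) (ℤ.pos-* p q) ⟨
    z ^ (p * q)             ≡⟨ P.cong (z ^_) (*-comm p q) ⟩
    z ^ (q * p)             ≈⟨ ^-* z q p ⟨
    (z ^ q) ^ p             ∎

  ^-homo : ∀ {φ} → IsGroupHomomorphism φ → ∀ {z w} n → φ z ≈ w → φ (z ^ n) ≈ w ^ n
  ^-homo hom zero    _    = ε-homo where open IsGroupHomomorphism hom
  ^-homo hom (suc n) φz≈w = trans (homo _ _) (∙-cong φz≈w (^-homo hom n φz≈w))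
    where open IsGroupHomomorphism hom

  module Order {z : Carrier} {o : ℕ} (ord : HasOrder z o) where
    instance
      o≢0 : NonZero o
      o≢0 = >-nonZero (proj₁ ord)

    z^o≈ε : z ^ o ≈ ε
    z^o≈ε = proj₁ (proj₂ ord)

    z^[o*q]≈ε : ∀ q → z ^ (o * q) ≈ ε
    z^[o*q]≈ε q = trans (sym (^-* z o q)) (trans (^-congˡ q z^o≈ε) (ε^ q))

    ^-reduce : ∀ a → z ^ a ≈ z ^ (a % o)
    ^-reduce a = begin
      z ^ a                          ≡⟨ P.cong (z ^_) (m≡m%n+[m/n]*n a o) ⟩
      z ^ (a % o + a / o * o)        ≈⟨ ^-+ z (a % o) (a / o * o) ⟩
      z ^ (a % o) ∙ z ^ (a / o * o)  ≡⟨ P.cong (λ e → z ^ (a % o) ∙ z ^ e) (*-comm (a / o) o) ⟩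
      z ^ (a % o) ∙ z ^ (o * (a / o)) ≈⟨ ∙-congˡ (z^[o*q]≈ε (a / o)) ⟩
      z ^ (a % o) ∙ ε                ≈⟨ identityʳ _ ⟩
      z ^ (a % o)                    ∎

    small-trivial⇒0 : ∀ r → r < o → z ^ r ≈ ε → r ≡ 0
    small-trivial⇒0 zero    _   _      = P.refl
    small-trivial⇒0 (suc r) r<o z^r≈ε = contradiction z^r≈ε (proj₂ (proj₂ ord) (suc r) (s≤s z≤n) r<o)

    ^≈ε⇒∣ : ∀ a → z ^ a ≈ ε → o ∣ a
    ^≈ε⇒∣ a z^a≈ε = m%n≡0⇒n∣m a o
      (small-trivial⇒0 (a % o) (m%n<n a o) (trans (sym (^-reduce a)) z^a≈ε))

    ^-difference : ∀ {u v} → u ≤ v → z ^ u ≈ z ^ v → z ^ (v ∸ u) ≈ ε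
    ^-difference {u} {v} u≤v z^u≈z^v = identityʳ-unique (z ^ u) _ (begin
      z ^ u ∙ z ^ (v ∸ u)  ≈⟨ ^-+ z u (v ∸ u) ⟨
      z ^ (u + (v ∸ u))    ≡⟨ P.cong (z ^_) (m+[n∸m]≡n u≤v) ⟩
      z ^ v                ≈⟨ z^u≈z^v ⟨
      z ^ u                ∎)

    ^-collapse : ∀ {p q} → p ≤ q → q < o → z ^ p ≈ z ^ q → q ≤ p
    ^-collapse {p} {q} p≤q q<o eq = m∸n≡0⇒m≤n
      (small-trivial⇒0 (q ∸ p) (≤-<-trans (m∸n≤m q p) q<o) (^-difference p≤q eq))

    ^-injective : ∀ {u v} → u < o → v < o → z ^ u ≈ z ^ v → u ≡ v
    ^-injective {u} {v} u<o v<o z^u≈z^v with ≤-total u v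
    ... | inj₁ u≤v = ≤-antisym u≤v (^-collapse u≤v v<o z^u≈z^v)
    ... | inj₂ v≤u = ≤-antisym (^-collapse v≤u u<o (sym z^u≈z^v)) v≤u

    exponent-congruence : ∀ u v → z ^ u ≈ z ^ v → ℤ.+ o ℤ∣.∣ ℤ.+ v ℤ.- ℤ.+ u
    exponent-congruence u v z^u≈z^v
      rewrite ℤ.m-n≡m⊖n v u with ≤-total u v
    ... | inj₁ u≤v rewrite ℤ.≤-⊖ u≤v =
          ∣ᵤ⇒∣ (^≈ε⇒∣ (v ∸ u) (^-difference u≤v z^u≈z^v))
    ... | inj₂ v≤u rewrite ℤ.⊖-≤ v≤u =
          ∣m⇒∣-m (∣ᵤ⇒∣ (^≈ε⇒∣ (u ∸ v) (^-difference v≤u (sym z^u≈z^v))))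

    ^-inverse : ∀ a → (z ^ a) ⁻¹ ≈ z ^ (o * a ∸ a)
    ^-inverse a = sym (inverseʳ-unique (z ^ a) (z ^ (o * a ∸ a)) (begin
      z ^ a ∙ z ^ (o * a ∸ a)  ≈⟨ ^-+ z a (o * a ∸ a) ⟨
      z ^ (a + (o * a ∸ a))    ≡⟨ P.cong (z ^_) (m+[n∸m]≡n (m≤n*m a o)) ⟩
      z ^ (o * a)              ≈⟨ z^[o*q]≈ε a ⟩
      ε                        ∎))

    cyclic⇒power : ∀ {g} → InCyclic z g → ∃ λ s → s < o × g ≈ z ^ s
    cyclic⇒power {g} (i , g≈z^i) = s % o , m%n<n s o , trans g≈z^s (^-reduce s)
      where
        natural : ∀ i → g ≈ z ^ℤ i → ∃ λ s → g ≈ z ^ s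
        natural (ℤ.+ s)     g≈z^s = s , g≈z^s
        natural ℤ.-[1+ s ]  g≈z^s = o * suc s ∸ suc s , trans g≈z^s (^-inverse (suc s))
        s = proj₁ (natural i g≈z^i)
        g≈z^s = proj₂ (natural i g≈z^i)

    power-order : ∀ {k} .{{_ : NonZero k}} → k ∣ o → HasOrder (z ^ (o / k)) k
    power-order {k} k∣o = >-nonZero⁻¹ k , trivial , minimal
      where
        d = o / k
        d*k≡o : d * k ≡ o
        d*k≡o = m/n*n≡m k∣o
        instance
          d≢0 : NonZero d
          d≢0 = >-nonZero (m≥n⇒m/n>0 (∣⇒≤ k∣o))
        trivial : (z ^ d) ^ k ≈ ε
        trivial = trans (^-* z d k) (trans (reflexive (P.cong (z ^_) d*k≡o)) z^o≈ε)
        minimal : ∀ u → 1 ≤ u → u < k → ¬ ((z ^ d) ^ u ≈ ε)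
        minimal u 1≤u u<k z^du≈ε = proj₂ (proj₂ ord) (d * u)
          (*-mono-≤ (>-nonZero⁻¹ d) 1≤u)
          (P.subst (d * u <_) d*k≡o (*-monoʳ-< d u<k))
          (trans (sym (^-* z d u)) z^du≈ε)

  record IsSubgroup (Q : Carrier → Set ℓ) : Set (c ⊔ ℓ) where
    field
      resp : ∀ {a b} → a ≈ b → Q a → Q b
      ε∈   : Q ε
      ∙∈   : ∀ {a b} → Q a → Q b → Q (a ∙ b)
      ⁻¹∈  : ∀ {a} → Q a → Q (a ⁻¹)

    ^∈ : ∀ {a} n → Q a → Q (a ^ n)
    ^∈ zero    _  = ε∈
    ^∈ (suc n) qa = ∙∈ qa (^∈ n qa)

  ∩-isSubgroup : ∀ {P Q} → IsSubgroup P → IsSubgroup Q → IsSubgroup (λ g → P g × Q g)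
  ∩-isSubgroup sp sq = record
    { resp = λ e (p , q) → P'.resp e p , Q'.resp e q
    ; ε∈   = P'.ε∈ , Q'.ε∈
    ; ∙∈   = λ (p , q) (p' , q') → P'.∙∈ p p' , Q'.∙∈ q q'
    ; ⁻¹∈  = λ (p , q) → P'.⁻¹∈ p , Q'.⁻¹∈ q
    }
    where
      module P' = IsSubgroup sp
      module Q' = IsSubgroup sq

  -- ⟨z⟩ is a subgroup (shown here for z of finite order, which is all we need)
  cyclic-isSubgroup : ∀ {z o} → HasOrder z o → IsSubgroup (InCyclic z)
  cyclic-isSubgroup {z} {o} ord = record
    { resp = λ a≈b (i , a≈z^i) → i , trans (sym a≈b) a≈z^i
    ; ε∈   = ℤ.+ 0 , refl
    ; ∙∈   = λ ga gb → ∙-closed (cyclic⇒power ga) (cyclic⇒power gb)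
    ; ⁻¹∈  = λ ga → ⁻¹-closed (cyclic⇒power ga)
    }
    where
      open Order ord
      ∙-closed : ∀ {a b} → ∃ (λ s → s < o × a ≈ z ^ s) → ∃ (λ t → t < o × b ≈ z ^ t) → InCyclic z (a ∙ b)
      ∙-closed (s , _ , a≈) (t , _ , b≈) = ℤ.+ (s + t) , trans (∙-cong a≈ b≈) (sym (^-+ z s t))
      ⁻¹-closed : ∀ {a} → ∃ (λ s → s < o × a ≈ z ^ s) → InCyclic z (a ⁻¹)
      ⁻¹-closed (s , _ , a≈) = ℤ.+ (o * s ∸ s) , trans (⁻¹-cong a≈) (^-inverse s)

  hasCard-unique : ∀ {Q : Carrier → Set ℓ} {k k'} → HasCard Q k → HasCard Q k' → k ≡ k'
  hasCard-unique A B = ≤-antisym (embedding A B) (embedding B A)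
    where
      -- sending each element of one enumeration to its index in the other is injective
      embedding : ∀ {Q : Carrier → Set ℓ} {k k'} → HasCard Q k → HasCard Q k' → k ≤ k'
      embedding {k = k} {k'} (f , f∈ , f-inj , _) (f' , _ , _ , f'-onto) = Fin.injective⇒≤ index-inj
        where
          index : Fin k → Fin k'
          index i = proj₁ (f'-onto (f i) (f∈ i))
          index-inj : ∀ {i j} → index i ≡ index j → i ≡ j
          index-inj {i} {j} eq = f-inj i j (begin
            f i            ≈⟨ proj₂ (f'-onto (f i) (f∈ i)) ⟨
            f' (index i)   ≡⟨ P.cong f' eq ⟩
            f' (index j)   ≈⟨ proj₂ (f'-onto (f j) (f∈ j)) ⟩
            f j            ∎)

  record CyclicGenerator (Q : Carrier → Set ℓ) (z : Carrier) (o k : ℕ) .{{_ : NonZero k}} : Set (c ⊔ ℓ) where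
    field
      k∣o        : k ∣ o
      generator∈ : Q (z ^ (o / k))
      generates  : ∀ {g} → Q g → ∃ λ j → g ≈ (z ^ (o / k)) ^ j

  module SubgroupOfCyclic {z o} (ord : HasOrder z o) {Q} (sub : IsSubgroup Q)
                          (Q⊆⟨z⟩ : ∀ {g} → Q g → InCyclic z g) {k} (card : HasCard Q k) where
    open Order ord
    open IsSubgroup sub

    power : ∀ {g} → Q g → ∃ λ s → s < o × g ≈ z ^ s
    power qg = cyclic⇒power (Q⊆⟨z⟩ qg)

    power∈ : ∀ {g} (qg : Q g) → Q (z ^ proj₁ (power qg))
    power∈ qg = resp (proj₂ (proj₂ (power qg))) qg

    -- the exponents of the enumerated elements of Q; d is the least positive one
    -- (or o, as z ^ o = ε lies in Q)
    exponent : Fin k → ℕ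
    exponent i = proj₁ (power (proj₁ (proj₂ card) i))

    positive-exponents : List ℕ
    positive-exponents = filter (1 ≤?_) (tabulate exponent)

    d : ℕ
    d = min o positive-exponents

    d-positive∈ : 1 ≤ d × Q (z ^ d)
    d-positive∈ = argmin-all id {P = λ s → 1 ≤ s × Q (z ^ s)} (proj₁ ord , resp (sym z^o≈ε) ε∈)
      (All.zip (all-filter (1 ≤?_) (tabulate exponent) ,
                filter⁺ (1 ≤?_) (tabulate⁺ (λ i → power∈ (proj₁ (proj₂ card) i)))))

    instance
      d≢0 : NonZero d
      d≢0 = >-nonZero (proj₁ d-positive∈)

    d-least : ∀ {s} → 1 ≤ s → s < o → Q (z ^ s) → d ≤ s
    d-least {s} 1≤s s<o qs = All.lookup (min≤xs o positive-exponents)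
      (∈-filter⁺ (1 ≤?_) (P.subst (_∈ tabulate exponent) exponent≡s (∈-tabulate⁺ i)) 1≤s)
      where
        onto = proj₂ (proj₂ (proj₂ card)) (z ^ s) qs
        i = proj₁ onto
        listed = power (proj₁ (proj₂ card) i)
        exponent≡s : exponent i ≡ s
        exponent≡s = ^-injective (proj₁ (proj₂ listed)) s<o
          (trans (sym (proj₂ (proj₂ listed))) (proj₂ onto))

    -- by minimality, every exponent of an element of Q is a multiple of d
    d-divides : ∀ {s} → Q (z ^ s) → d ∣ s
    d-divides {s} qs = m%n≡0⇒n∣m s d (below-d⇒0 (s % d) (m%n<n s d) remainder∈)
      where
        below-d⇒0 : ∀ r → r < d → Q (z ^ r) → r ≡ 0
        below-d⇒0 zero    _   _  = P.refl
        below-d⇒0 (suc r) r<d qr =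
          contradiction (d-least (s≤s z≤n) (<-≤-trans r<d (min≤⊤ o positive-exponents)) qr) (<⇒≱ r<d)
        w = z ^ (s / d * d)
        remainder∈ : Q (z ^ (s % d))
        remainder∈ = resp (begin
          z ^ s ∙ w ⁻¹              ≈⟨ ∙-congʳ (trans (reflexive (P.cong (z ^_) (m≡m%n+[m/n]*n s d)))
                                                      (^-+ z (s % d) (s / d * d))) ⟩
          (z ^ (s % d) ∙ w) ∙ w ⁻¹  ≈⟨ //-rightDividesʳ w (z ^ (s % d)) ⟩
          z ^ (s % d)               ∎)
          (∙∈ qs (⁻¹∈ (resp (trans (^-* z d (s / d)) (reflexive (P.cong (z ^_) (*-comm d (s / d)))))
                            (^∈ (s / d) (proj₂ d-positive∈)))))

    d∣o : d ∣ o
    d∣o = d-divides (resp (sym z^o≈ε) ε∈)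

    generates : ∀ {g} → Q g → ∃ λ j → g ≈ (z ^ d) ^ j
    generates {g} qg = s / d , (begin
      g                  ≈⟨ proj₂ (proj₂ (power qg)) ⟩
      z ^ s              ≡⟨ P.cong (z ^_) (m*[n/m]≡n (d-divides (power∈ qg))) ⟨
      z ^ (d * (s / d))  ≈⟨ ^-* z d (s / d) ⟨
      (z ^ d) ^ (s / d)  ∎)
      where s = proj₁ (power qg)

    card-o/d : HasCard Q (o / d)
    card-o/d = element , element∈ , element-inj , element-onto
      where
        element : Fin (o / d) → Carrier
        element t = z ^ (d * Fin.toℕ t)
        element∈ : ∀ t → Q (element t)
        element∈ t = resp (^-* z d (Fin.toℕ t)) (^∈ (Fin.toℕ t) (proj₂ d-positive∈))
        exponent<o : ∀ t → d * Fin.toℕ t < o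
        exponent<o t = P.subst (d * Fin.toℕ t <_) (m*[n/m]≡n d∣o) (*-monoʳ-< d (Fin.toℕ<n t))
        element-inj : ∀ t t' → element t ≈ element t' → t ≡ t'
        element-inj t t' eq = Fin.toℕ-injective
          (*-cancelˡ-≡ (Fin.toℕ t) (Fin.toℕ t') d (^-injective (exponent<o t) (exponent<o t') eq))
        element-onto : ∀ g → Q g → ∃ λ t → element t ≈ g
        element-onto g qg = Fin.fromℕ< s/d<o/d , (begin
          z ^ (d * Fin.toℕ (Fin.fromℕ< s/d<o/d))  ≡⟨ P.cong (λ e → z ^ (d * e)) (Fin.toℕ-fromℕ< s/d<o/d) ⟩
          z ^ (d * (s / d))                      ≡⟨ P.cong (z ^_) (m*[n/m]≡n (d-divides (power∈ qg))) ⟩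
          z ^ s                                  ≈⟨ proj₂ (proj₂ (power qg)) ⟨
          g                                      ∎)
          where
            s = proj₁ (power qg)
            s/d<o/d : s / d < o / d
            s/d<o/d = m<n*o⇒m/o<n (P.subst (s <_) (P.sym (m/n*n≡m d∣o)) (proj₁ (proj₂ (power qg))))

    d*k≡o : d * k ≡ o
    d*k≡o = P.trans (P.cong (d *_) (hasCard-unique card card-o/d)) (m*[n/m]≡n d∣o)

    cyclicGenerator : .{{_ : NonZero k}} → CyclicGenerator Q z o k
    cyclicGenerator = record
      { k∣o        = P.subst (k ∣_) d*k≡o (n∣m*n d)
      ; generator∈ = P.subst (λ e → Q (z ^ e)) (P.sym o/k≡d) (proj₂ d-positive∈)
      ; generates  = λ qg → P.subst (λ e → ∃ λ j → _ ≈ (z ^ e) ^ j) (P.sym o/k≡d) (generates qg)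
      }
      where
        o/k≡d : o / k ≡ d
        o/k≡d = P.trans (/-congˡ (P.sym d*k≡o)) (m*n/n≡m d k)

  -- a homomorphism sending z to w transports z ^ o = ε, so o(w) divides o(z)
  hom-order-∣ : ∀ {φ z w o p} → IsGroupHomomorphism φ →
                HasOrder z o → HasOrder w p → φ z ≈ w → p ∣ o
  hom-order-∣ {φ} {z} {w} {o} hom ord-z ord-w φz≈w = Order.^≈ε⇒∣ ord-w o (begin
    w ^ o      ≈⟨ ^-homo hom o φz≈w ⟨
    φ (z ^ o)  ≈⟨ ⟦⟧-cong (Order.z^o≈ε ord-z) ⟩
    φ ε        ≈⟨ ε-homo ⟩
    ε          ∎)
    where open IsGroupHomomorphism hom

  mutual-powers : ∀ {a b} j i → a ≈ b ^ j → b ≈ a ^ i → b ^ 1 ≈ b ^ (j * i)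
  mutual-powers {a} {b} j i a≈b^j b≈a^i = begin
    b ^ 1        ≈⟨ identityʳ b ⟩
    b            ≈⟨ b≈a^i ⟩
    a ^ i        ≈⟨ ^-congˡ i a≈b^j ⟩
    (b ^ j) ^ i  ≈⟨ ^-* b j i ⟩
    b ^ (j * i)  ∎

  -- if a homomorphism swaps a and b and a = b ^ j, then b = a ^ j, so b = b ^ (j·j)
  swapped-powers : ∀ {φ a b} j → IsGroupHomomorphism φ →
                   φ a ≈ b → φ b ≈ a → a ≈ b ^ j → b ^ 1 ≈ b ^ (j * j)
  swapped-powers {φ} {a} {b} j hom φa≈b φb≈a a≈b^j = mutual-powers j j a≈b^j (begin
    b          ≈⟨ φa≈b ⟨
    φ a        ≈⟨ ⟦⟧-cong a≈b^j ⟩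
    φ (b ^ j)  ≈⟨ ^-homo hom j φb≈a ⟩
    a ^ j      ∎)
    where open IsGroupHomomorphism hom

  coprime-exponent : ∀ {a b k} j i → HasOrder b k → a ≈ b ^ j → b ≈ a ^ i → Coprime j k
  coprime-exponent j i ord-b a≈b^j b≈a^i = invertible⇒coprime
    (Order.exponent-congruence ord-b 1 (j * i) (mutual-powers j i a≈b^j b≈a^i))

  square-exponent : ∀ {φ a b k} j → IsGroupHomomorphism φ → HasOrder b k →
                    φ a ≈ b → φ b ≈ a → a ≈ b ^ j → ℤ.+ k ℤᵘ.∣ ℤ.+ j ℤ.* ℤ.+ j ℤ.- ℤ.+ 1
  square-exponent {k = k} j hom ord-b φa≈b φb≈a a≈b^j =
    P.subst (λ e → ℤ.+ k ℤᵘ.∣ e ℤ.- ℤ.+ 1) (ℤ.pos-* j j) (∣⇒∣ᵤ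
      (Order.exponent-congruence ord-b 1 (j * j) (swapped-powers j hom φa≈b φb≈a a≈b^j)))

  swapped-orders : ∀ {φ x y l m} → IsGroupHomomorphism φ →
                   HasOrder x l → HasOrder y m → φ x ≈ y → φ y ≈ x → l ≡ m
  swapped-orders hom ord-x ord-y φx≈y φy≈x =
    ∣-antisym (hom-order-∣ hom ord-y ord-x φy≈x) (hom-order-∣ hom ord-x ord-y φx≈y)

open import Data.Nat using (NonZero)
open import Data.Integer using (ℤ; +_; _*_; _-_; ∣_∣)
open import Data.Integer.Divisibility using (_∣_)

proposition2p4 : ∀ {c ℓ : Level} (G : Group c ℓ) → let open GroupDefs G in
    (x y : Carrier) (l m n k : ℕ) →
    IsFinite → Generates x y →
    HasOrder x l → HasOrder y m → HasOrder (x ∙ y) n →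
    HasCard (λ g → InCyclic x g × InCyclic y g) k → (hk : 1 ≤ k) →
    ∃ λ (e : ℤ) → Coprime ∣ e ∣ k
      × (x ^ ((l / k) {{>-nonZero hk}}) ≈ y ^ℤ (e * + ((m / k) {{>-nonZero hk}})))
      × (IsSymmetric x y → (l ≡ m) × (+ k ∣ (e * e - + 1)))
proposition2p4 G x y l m n k _ _ ord-x ord-y _ card-K hk =
  + j , coprime-exponent j i b-order a≈b^j b≈a^i , trans a≈b^j (sym (^ℤ-pos-* y j (m / k))) , symmetric
  where
    open Group G using (_≈_; trans; sym; reflexive)
    open GroupDefs G using (_^_; InCyclic; IsSymmetric; HasOrder)
    open GroupMorphisms (Group.rawGroup G) (Group.rawGroup G) using (module IsGroupIsomorphism)
    open CyclicSubgroups G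
    instance
      k≢0 : NonZero k
      k≢0 = >-nonZero hk
    K-subgroup : IsSubgroup (λ g → InCyclic x g × InCyclic y g)
    K-subgroup = ∩-isSubgroup (cyclic-isSubgroup ord-x) (cyclic-isSubgroup ord-y)
    module A = CyclicGenerator (SubgroupOfCyclic.cyclicGenerator ord-x K-subgroup proj₁ card-K)
    module B = CyclicGenerator (SubgroupOfCyclic.cyclicGenerator ord-y K-subgroup proj₂ card-K)
    b-order : HasOrder (y ^ (m / k)) k
    b-order = Order.power-order ord-y B.k∣o
    j = proj₁ (B.generates A.generator∈)
    a≈b^j = proj₂ (B.generates A.generator∈)
    i = proj₁ (A.generates B.generator∈)
    b≈a^i = proj₂ (A.generates B.generator∈)
    -- an automorphism swapping x and y preserves orders and swaps a and b
    symmetric : IsSymmetric x y → (l ≡ m) × (+ k ∣ (+ j * + j - + 1))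
    symmetric (φ , iso , φx≈y , φy≈x) = l≡m , square-exponent j hom b-order φa≈b φb≈a a≈b^j
      where
        hom = IsGroupIsomorphism.isGroupHomomorphism iso
        l≡m = swapped-orders hom ord-x ord-y φx≈y φy≈x
        φa≈b = trans (^-homo hom (l / k) φx≈y) (reflexive (P.cong (λ e → y ^ (e / k)) l≡m))
        φb≈a = trans (^-homo hom (m / k) φy≈x) (reflexive (P.cong (λ e → x ^ (e / k)) (P.sym l≡m)))
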